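{- Let $\mathcal{L}$ be a finite distributive lattice with set of join-irreducibles $J$ (convention below). Then $n(\mathcal{L}) = |\mathcal{L}| - |J|$ if and only if $\mathcal{L}$ is isomorphic to a concatenation $\mathcal{L}_1\#\mathcal{L}_2\#\cdots\#\mathcal{L}_m$ in which each $\mathcal{L}_i$ is either a diamond (the four-element Boolean lattice $\{\hat0,a,b,\hat1\}$ with $a,b$ non-comparable) or a chain of arbitrary length.
   Context: $n(\mathcal{L})$ is the number of unordered pairs of non-comparable elements of $\mathcal{L}$. $J$ is the set of join-irreducible elements of $\mathcal{L}$, with the minimum $\hat0$ counted as join-irreducible, so $|J|$ equals the number of elements in a maximal chain of $\mathcal{L}$. Concatenation: for finite lattices $\mathcal{L}_1$ with maximum $\hat1$ and $\mathcal{L}_2$ with minimum $\hat0$, $\mathcal{L}_1\#\mathcal{L}_2$ is the disjoint union $\mathcal{L}_1\cup\mathcal{L}_2$ with $\hat1\in\mathcal{L}_1$ identified with $\hat0\in\mathcal{L}_2$, ordered by the orders of $\mathcal{L}_1$ and $\mathcal{L}_2$ and by declaring every element of $\mathcal{L}_2$ to be $\ge$ every element of $\mathcal{L}_1$. -}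

module Defs where

open import Level using (0ℓ)
open import Data.Nat using (ℕ; zero; suc)
open import Data.Fin using (Fin; toℕ; fromℕ; _≟_) renaming (_≤_ to _≤ᶠ_; _<_ to _<ᶠ_)
open import Data.Fin.Properties using (all?) renaming (_<?_ to _<ᶠ?_)
open import Data.Bool using (Bool; true; false) renaming (_≤_ to _≤ᵇ_)
open import Data.Product using (_×_; _,_; Σ; ∃; ∃-syntax; proj₁; proj₂)
open import Data.Product.Relation.Binary.Pointwise.NonDependent using (Pointwise)
open import Data.Sum using (_⊎_; inj₁; inj₂)
open import Data.List using (List; []; _∷_; length; filter; allFin; cartesianProduct)
open import Data.List.NonEmpty using (List⁺; _∷_)
open import Function.Bundles using (_⇔_)
open import Relation.Nullary using (¬_; Dec; ¬?)
open import Relation.Nullary.Decidable using (_×-dec_; _⊎-dec_; _→-dec_)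
open import Relation.Binary using (Rel; Decidable)
open import Relation.Binary.PropositionalEquality using (_≡_)
open import Relation.Binary.Lattice.Structures using (IsDistributiveLattice)

-- A finite distributive lattice on n elements, carrier Fin n,
-- with propositional equality.  The order is given together with a
-- decision procedure (needed only for counting).

record FinDistLattice (n : ℕ) : Set₁ where
  field
    _≤_    : Rel (Fin n) 0ℓ
    _∨_    : Fin n → Fin n → Fin n
    _∧_    : Fin n → Fin n → Fin n
    isDistributiveLattice : IsDistributiveLattice _≡_ _≤_ _∨_ _∧_
    _≤?_   : Decidable _≤_

module _ {n : ℕ} (L : FinDistLattice n) where
  open FinDistLattice L

  Incomparable : Fin n → Fin n → Set
  Incomparable x y = ¬ (x ≤ y) × ¬ (y ≤ x)

  -- an unordered pair {x , y} is represented by the ordered pair with x < y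
  IncomparablePair : Fin n × Fin n → Set
  IncomparablePair (x , y) = (x <ᶠ y) × Incomparable x y

  incomparablePair? : (p : Fin n × Fin n) → Dec (IncomparablePair p)
  incomparablePair? (x , y) = (x <ᶠ? y) ×-dec (¬? (x ≤? y) ×-dec ¬? (y ≤? x))

  nIncomparable : ℕ
  nIncomparable = length (filter incomparablePair? (cartesianProduct (allFin n) (allFin n)))

  -- J : join-irreducible elements, with the minimum counted as
  -- join-irreducible.  (x = y ∨ z implies x = y or x = z; the minimum
  -- satisfies this, and for x ≠ 0̂ it is the usual join-irreducibility.)
  JoinIrreducible : Fin n → Set
  JoinIrreducible x = ∀ y z → x ≡ (y ∨ z) → (x ≡ y) ⊎ (x ≡ z)

  joinIrreducible? : (x : Fin n) → Dec (JoinIrreducible x)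
  joinIrreducible? x = all? λ y → all? λ z →
    (x ≟ (y ∨ z)) →-dec ((x ≟ y) ⊎-dec (x ≟ z))

  numJ : ℕ
  numJ = length (filter joinIrreducible? (allFin n))

record BPoset : Set₁ where
  field
    Carrier : Set
    _≼_     : Carrier → Carrier → Set
    bot     : Carrier
    top     : Carrier

open BPoset

-- The carrier is the disjoint union; the order is
-- the preorder in which inj₁ (top L₁) and inj₂ (bot L₂) are equivalent,
-- so that its antisymmetric quotient is exactly L₁ # L₂ (the disjoint union
-- with top of L₁ identified with bot of L₂, every element of L₂ above
-- every element of L₁).
data ConcatLe (L₁ L₂ : BPoset) : Carrier L₁ ⊎ Carrier L₂ → Carrier L₁ ⊎ Carrier L₂ → Set where
  le₁₁ : ∀ {x y} → _≼_ L₁ x y → ConcatLe L₁ L₂ (inj₁ x) (inj₁ y)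
  le₂₂ : ∀ {x y} → _≼_ L₂ x y → ConcatLe L₁ L₂ (inj₂ x) (inj₂ y)
  le₁₂ : ∀ {x y} → ConcatLe L₁ L₂ (inj₁ x) (inj₂ y)
  le₂₁ : ∀ {y x} → _≼_ L₂ y (bot L₂) → _≼_ L₁ (top L₁) x → ConcatLe L₁ L₂ (inj₂ y) (inj₁ x)

_#_ : BPoset → BPoset → BPoset
L₁ # L₂ = record
  { Carrier = Carrier L₁ ⊎ Carrier L₂
  ; _≼_     = ConcatLe L₁ L₂
  ; bot     = inj₁ (bot L₁)
  ; top     = inj₂ (top L₂)
  }

-- the chain with (suc k) elements 0 < 1 < … < k
chain : ℕ → BPoset
chain k = record { Carrier = Fin (suc k) ; _≼_ = _≤ᶠ_ ; bot = Fin.zero ; top = fromℕ k }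
  where import Data.Fin as Fin

diamond : BPoset
diamond = record
  { Carrier = Bool × Bool
  ; _≼_     = Pointwise _≤ᵇ_ _≤ᵇ_
  ; bot     = (false , false)
  ; top     = (true , true)
  }

data Piece : Set where
  dia : Piece
  chn : ℕ → Piece

⟦_⟧ : Piece → BPoset
⟦ dia ⟧   = diamond
⟦ chn k ⟧ = chain k

concatAll : BPoset → List BPoset → BPoset
concatAll L []       = L
concatAll L (M ∷ Ms) = L # concatAll M Ms

concatPieces : List⁺ Piece → BPoset
concatPieces (p ∷ ps) = concatAll ⟦ p ⟧ (Data.List.map ⟦_⟧ ps)
  where import Data.List

-- Order isomorphism between a finite lattice L and (the antisymmetric
-- quotient of) a bounded preorder P.  Lattice isomorphism = order
-- isomorphism for lattices.

record _≅_ {n : ℕ} (L : FinDistLattice n) (P : BPoset) : Set where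
  open FinDistLattice L
  field
    to      : Fin n → Carrier P
    from    : Carrier P → Fin n
    to-mono : ∀ x y → (x ≤ y) ⇔ _≼_ P (to x) (to y)
    from-to : ∀ x → from (to x) ≡ x
    to-from : ∀ c → _≼_ P (to (from c)) c × _≼_ P c (to (from c))

IsConcatOfDiamondsAndChains : {n : ℕ} → FinDistLattice n → Set
IsConcatOfDiamondsAndChains L = ∃[ ps ] (L ≅ concatPieces ps)

-- Mapping an incomparable pair {x, y} to x ∨ y sends the n(L) incomparable pairs onto the |L| − |J|
-- join-reducible elements, so n(L) = |L| − |J| exactly when every join-reducible element is the join of a
-- unique incomparable pair.  In a concatenation of diamonds and chains the only incomparable pairs are the two
-- atoms of a diamond, whose joins are distinct tops.  Conversely, under this uniqueness an element m has at most
-- two upper covers, and every element above m is comparable with the join t of its covers.  So ↑m is the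
-- interval [m, t], a two-element chain or a diamond by distributivity, with ↑t stacked on top, and recursion
-- from the bottom of L decomposes L.

module Submission where

open import Defs
open import Level using (0ℓ)
open import Data.Bool using (Bool; true; false; b≤b; f≤t) renaming (_≤_ to _≤ᵇ_)
import Data.Bool.Properties as Bool
open import Data.Empty using (⊥; ⊥-elim)
open import Data.Fin using (Fin; _≟_) renaming (_≤_ to _≤ᶠ_)
open import Data.Fin.Patterns using (0F; 1F)
import Data.Fin.Properties as Fin
open import Data.List using (List; []; _∷_; length; map; filter; allFin; cartesianProduct)
open import Data.List.NonEmpty using (_∷_; _∷⁺_)
open import Data.List.Properties using (length-map; length-tabulate; filter-notAll)
open import Data.List.Membership.Propositional using (_∈_; _∉_)
open import Data.List.Membership.Propositional.Properties
  using (∈-filter⁺; ∈-filter⁻; ∈-map⁺; ∈-map⁻; ∈-allFin; ∈-cartesianProduct⁺)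
open import Data.List.Relation.Binary.Subset.Propositional using (_⊆_)
open import Data.List.Relation.Unary.All as All using (All; []; _∷_)
open import Data.List.Relation.Unary.All.Properties using (All¬⇒¬Any) renaming (map⁺ to All-map⁺)
open import Data.List.Relation.Unary.Any as Any using (here; there)
open import Data.List.Relation.Unary.AllPairs using ([]; _∷_)
open import Data.List.Relation.Unary.Unique.Propositional using (Unique)
open import Data.List.Relation.Unary.Unique.Propositional.Properties using (allFin⁺; filter⁺; cartesianProduct⁺)
open import Data.Nat using (ℕ; suc; _+_; _∸_; z≤n; s≤s)
open import Data.Nat.Induction using (<-wellFounded)
open import Data.Nat.Properties using (+-suc; <⇒≱; m+n∸m≡n; ≤-antisym; ≤-reflexive; module ≤-Reasoning)
open import Data.Product using (_×_; _,_; proj₁; proj₂; ∃; ∃₂)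
open import Data.Product.Properties using (≡-dec)
open import Data.Sum using (_⊎_; inj₁; inj₂; [_,_]; map₁)
open import Function using (_∘_; _$_; _on_)
open import Function.Bundles using (_⇔_; mk⇔; Equivalence)
open import Induction.WellFounded using (Acc; acc)
open import Relation.Binary using (DecidableEquality; tri<; tri≈; tri>)
import Relation.Binary.Construct.On as On
open import Relation.Binary.Lattice.Bundles using (DistributiveLattice)
import Relation.Binary.Lattice.Properties.JoinSemilattice as JoinSemilatticeProperties
import Relation.Binary.Lattice.Properties.MeetSemilattice as MeetSemilatticeProperties
open import Relation.Binary.PropositionalEquality
  using (_≡_; _≢_; refl; sym; trans; cong; cong₂; subst; subst₂; module ≡-Reasoning)
open import Relation.Nullary using (¬_; Dec; yes; no; ¬?; contradiction; _×-dec_)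
open import Relation.Nullary.Decidable using (does; decidable-stable)

module _ {A : Set} {P : A → Set} (P? : ∀ x → Dec (P x)) where

  length-filter+length-filter-∁ : ∀ xs → length (filter P? xs) + length (filter (¬? ∘ P?) xs) ≡ length xs
  length-filter+length-filter-∁ []       = refl
  length-filter+length-filter-∁ (x ∷ xs) with P? x
  ... | yes _ = cong suc (length-filter+length-filter-∁ xs)
  ... | no  _ = trans (+-suc _ _) (cong suc (length-filter+length-filter-∁ xs))

module _ {A : Set} (_≟ᴬ_ : DecidableEquality A) where
  open import Data.Nat using (_≤_; _<_)

  Unique-⊆⇒length≤ : {xs ys : List A} → Unique xs → xs ⊆ ys → length xs ≤ length ys
  Unique-⊆-∉⇒length< : {xs ys : List A} {y : A} → Unique xs → xs ⊆ ys → y ∈ ys → y ∉ xs →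
                       length xs < length ys

  Unique-⊆⇒length≤ {[]}     _            _     = z≤n
  Unique-⊆⇒length≤ {x ∷ xs} (x∉xs ∷ uxs) x∷xs⊆ =
    Unique-⊆-∉⇒length< uxs (x∷xs⊆ ∘ there) (x∷xs⊆ (here refl)) (All¬⇒¬Any x∉xs)

  Unique-⊆-∉⇒length< {xs} {ys} {y} uxs xs⊆ys y∈ys y∉xs = begin-strict
    length xs             ≤⟨ Unique-⊆⇒length≤ uxs xs⊆ys∖y ⟩
    length (filter P? ys) <⟨ filter-notAll P? ys (Any.map (λ y≡z z≢y → z≢y (sym y≡z)) y∈ys) ⟩
    length ys             ∎
    where
    open ≤-Reasoning
    P? = λ z → ¬? (z ≟ᴬ y)
    xs⊆ys∖y : xs ⊆ filter P? ys
    xs⊆ys∖y z∈xs = ∈-filter⁺ P? (xs⊆ys z∈xs) (λ { refl → y∉xs z∈xs })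

  filter-⊂⇒length< : {P Q : A → Set} (P? : ∀ x → Dec (P x)) (Q? : ∀ x → Dec (Q x)) {xs : List A} {w : A} →
                      Unique xs → (∀ {z} → P z → Q z) → w ∈ xs → Q w → ¬ P w →
                      length (filter P? xs) < length (filter Q? xs)
  filter-⊂⇒length< P? Q? {xs} uxs P⊆Q w∈xs Qw ¬Pw = Unique-⊆-∉⇒length< (filter⁺ P? uxs)
    (λ z∈ → let z∈xs , Pz = ∈-filter⁻ P? {xs = xs} z∈ in ∈-filter⁺ Q? z∈xs (P⊆Q Pz))
    (∈-filter⁺ Q? w∈xs Qw) (¬Pw ∘ proj₂ ∘ ∈-filter⁻ P? {xs = xs})

module _ {A B : Set} (f : A → B) where
  open import Data.Nat using (_≤_; _<_)

  InjectiveOn : List A → Set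
  InjectiveOn xs = ∀ {x x′} → x ∈ xs → x′ ∈ xs → f x ≡ f x′ → x ≡ x′

  Unique-map⁺ : {xs : List A} → InjectiveOn xs → Unique xs → Unique (map f xs)
  Unique-map⁺ {[]}     _   []          = []
  Unique-map⁺ {x ∷ xs} inj (x∉xs ∷ uxs) =
    All-map⁺ (All.tabulate λ z∈xs fx≡fz → All.lookup x∉xs z∈xs (inj (here refl) (there z∈xs) fx≡fz))
    ∷ Unique-map⁺ (λ p q → inj (there p) (there q)) uxs

  onto-shorter⇒InjectiveOn : DecidableEquality A → DecidableEquality B →
    {xs : List A} {ys : List B} → Unique ys → ys ⊆ map f xs → length xs ≤ length ys → InjectiveOn xs
  onto-shorter⇒InjectiveOn _≟ᴬ_ _≟ᴮ_ {xs} {ys} uys ys⊆fxs xs≤ys {x} {x′} x∈xs x′∈xs fx≡fx′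
    with x ≟ᴬ x′
  ... | yes x≡x′ = x≡x′
  ... | no  x≢x′ = contradiction xs≤ys (<⇒≱ (begin-strict
    length ys                     ≤⟨ Unique-⊆⇒length≤ _≟ᴮ_ uys ys⊆fxs∖x ⟩
    length (map f (filter P? xs)) ≡⟨ length-map f (filter P? xs) ⟩
    length (filter P? xs)         <⟨ filter-notAll P? xs (Any.map (λ x≡z z≢x → z≢x (sym x≡z)) x∈xs) ⟩
    length xs                     ∎))
    where
    open ≤-Reasoning
    P? = λ z → ¬? (z ≟ᴬ x)
    ys⊆fxs∖x : ys ⊆ map f (filter P? xs)
    ys⊆fxs∖x y∈ys with ∈-map⁻ f (ys⊆fxs y∈ys)
    ... | z , z∈xs , refl with z ≟ᴬ x
    ...   | yes refl =
      subst (_∈ map f (filter P? xs)) (sym fx≡fx′) (∈-map⁺ f (∈-filter⁺ P? x′∈xs (x≢x′ ∘ sym)))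
    ...   | no  z≢x  = ∈-map⁺ f (∈-filter⁺ P? z∈xs z≢x)

module LatticeProperties {n : ℕ} (L : FinDistLattice n) where
  open FinDistLattice L public

  distributiveLattice : DistributiveLattice 0ℓ 0ℓ 0ℓ
  distributiveLattice = record { isDistributiveLattice = isDistributiveLattice }

  open DistributiveLattice distributiveLattice public
    using (antisym; x≤x∨y; y≤x∨y; ∨-least; x∧y≤x; x∧y≤y; ∧-greatest; ∧-distribˡ-∨)
    renaming (refl to ≤-refl; trans to ≤-trans)
  open JoinSemilatticeProperties (DistributiveLattice.joinSemilattice distributiveLattice) public
    using (∨-comm; ∨-assoc; ∨-idempotent; ∨-monotonic; x≤y⇒x∨y≈y)
  open MeetSemilatticeProperties (DistributiveLattice.meetSemilattice distributiveLattice) public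
    using (∧-comm; y≤x⇒x∧y≈y)

  x≤y⇒x∧y≡x : ∀ {x y} → x ≤ y → x ∧ y ≡ x
  x≤y⇒x∧y≡x {x} {y} x≤y = trans (∧-comm x y) (y≤x⇒x∧y≈y x≤y)

  ≤∨⇒≡∧∨∧ : ∀ {x a b} → x ≤ (a ∨ b) → x ≡ (x ∧ a) ∨ (x ∧ b)
  ≤∨⇒≡∧∨∧ {x} {a} {b} x≤a∨b = trans (sym (x≤y⇒x∧y≡x x≤a∨b)) (∧-distribˡ-∨ x a b)

  lower-bound : Fin n → ∀ xs → ∃ λ z → All (z ≤_) xs
  lower-bound d []       = d , []
  lower-bound d (x ∷ xs) =
    let z , z≤xs = lower-bound d xs in x ∧ z , x∧y≤x x z ∷ All.map (≤-trans (x∧y≤y x z)) z≤xs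

  minimum : Fin n → ∃ λ z → ∀ x → z ≤ x
  minimum d = let z , z≤all = lower-bound d (allFin n) in z , λ x → All.lookup z≤all (∈-allFin x)

  _∥_ : Fin n → Fin n → Set
  _∥_ = Incomparable L

module _ {n : ℕ} (L : FinDistLattice n) where
  open LatticeProperties L

  UniqueIncomparableJoins : Set
  UniqueIncomparableJoins = ∀ {x y u v} → x ∥ y → u ∥ v → x ∨ y ≡ u ∨ v →
                            (x ≡ u × y ≡ v) ⊎ (x ≡ v × y ≡ u)

module Counting {n : ℕ} (L : FinDistLattice n) where
  open LatticeProperties L

  incomparablePairs : List (Fin n × Fin n)
  incomparablePairs = filter (incomparablePair? L) (cartesianProduct (allFin n) (allFin n))

  joinReducibles : List (Fin n)
  joinReducibles = filter (¬? ∘ joinIrreducible? L) (allFin n)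

  join : Fin n × Fin n → Fin n
  join (x , y) = x ∨ y

  ∈-incomparablePairs⁻ : ∀ {p} → p ∈ incomparablePairs → IncomparablePair L p
  ∈-incomparablePairs⁻ = proj₂ ∘ ∈-filter⁻ (incomparablePair? L) {xs = cartesianProduct (allFin n) (allFin n)}

  ∈-joinReducibles⁻ : ∀ {z} → z ∈ joinReducibles → ¬ JoinIrreducible L z
  ∈-joinReducibles⁻ = proj₂ ∘ ∈-filter⁻ (¬? ∘ joinIrreducible? L) {xs = allFin n}

  length-joinReducibles : length joinReducibles ≡ n ∸ numJ L
  length-joinReducibles = begin
    length joinReducibles                   ≡⟨ m+n∸m≡n (numJ L) _ ⟨
    numJ L + length joinReducibles ∸ numJ L ≡⟨ cong (_∸ numJ L) (length-filter+length-filter-∁ _ (allFin n)) ⟩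
    length (allFin n) ∸ numJ L              ≡⟨ cong (_∸ numJ L) (length-tabulate (λ x → x)) ⟩
    n ∸ numJ L                              ∎
    where open ≡-Reasoning

  incomparable⇒joinReducible : ∀ {x y} → x ∥ y → ¬ JoinIrreducible L (x ∨ y)
  incomparable⇒joinReducible {x} {y} (x≰y , y≰x) ji with ji x y refl
  ... | inj₁ x∨y≡x = y≰x (subst (y ≤_) x∨y≡x (y≤x∨y x y))
  ... | inj₂ x∨y≡y = x≰y (subst (x ≤_) x∨y≡y (x≤x∨y x y))

  joinReducible⇒incomparableJoin : ∀ {z} → ¬ JoinIrreducible L z → ∃₂ λ x y → x ∥ y × x ∨ y ≡ z
  joinReducible⇒incomparableJoin {z} z-reducible
    with Fin.any? (λ x → Fin.any? λ y → ((x ∨ y) ≟ z) ×-dec (¬? (x ≤? y) ×-dec ¬? (y ≤? x)))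
  ... | yes (x , y , x∨y≡z , x∥y) = x , y , x∥y , x∨y≡z
  ... | no  none                  = contradiction z-irreducible z-reducible
    where
    z-irreducible : JoinIrreducible L z
    z-irreducible x y z≡x∨y with x ≤? y | y ≤? x
    ... | yes x≤y | _       = inj₂ (trans z≡x∨y (x≤y⇒x∨y≈y x≤y))
    ... | no  _   | yes y≤x = inj₁ (trans z≡x∨y (trans (∨-comm x y) (x≤y⇒x∨y≈y y≤x)))
    ... | no  x≰y | no  y≰x = contradiction (x , y , sym z≡x∨y , x≰y , y≰x) none

  ∈-incomparablePairs⁺ : ∀ {p} → IncomparablePair L p → p ∈ incomparablePairs
  ∈-incomparablePairs⁺ {x , y} = ∈-filter⁺ (incomparablePair? L) (∈-cartesianProduct⁺ (∈-allFin x) (∈-allFin y))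

  incomparable⇒∈-incomparablePairs : ∀ {x y} → x ∥ y →
    ∃ λ p → p ∈ incomparablePairs × (p ≡ (x , y) ⊎ p ≡ (y , x))
  incomparable⇒∈-incomparablePairs {x} {y} x∥y@(x≰y , y≰x) with Fin.<-cmp x y
  ... | tri< x<y _ _  = (x , y) , ∈-incomparablePairs⁺ (x<y , x∥y) , inj₁ refl
  ... | tri≈ _ refl _ = contradiction ≤-refl x≰y
  ... | tri> _ _ y<x  = (y , x) , ∈-incomparablePairs⁺ (y<x , y≰x , x≰y) , inj₂ refl

  join-of-ordering : ∀ {p x y} → p ≡ (x , y) ⊎ p ≡ (y , x) → join p ≡ x ∨ y
  join-of-ordering (inj₁ refl) = refl
  join-of-ordering (inj₂ refl) = ∨-comm _ _

  joins⊆joinReducibles : map join incomparablePairs ⊆ joinReducibles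
  joins⊆joinReducibles z∈ with ∈-map⁻ join z∈
  ... | (x , y) , p∈ , refl = ∈-filter⁺ (¬? ∘ joinIrreducible? L) (∈-allFin (x ∨ y))
    (incomparable⇒joinReducible (proj₂ (∈-incomparablePairs⁻ p∈)))

  joinReducibles⊆joins : joinReducibles ⊆ map join incomparablePairs
  joinReducibles⊆joins z∈ with joinReducible⇒incomparableJoin (∈-joinReducibles⁻ z∈)
  ... | x , y , x∥y , refl with incomparable⇒∈-incomparablePairs x∥y
  ...   | p , p∈ , p≡ = subst (_∈ map join incomparablePairs) (join-of-ordering p≡) (∈-map⁺ join p∈)

  uniqueIncomparableJoins⇒injectiveOn : UniqueIncomparableJoins L → InjectiveOn join incomparablePairs
  uniqueIncomparableJoins⇒injectiveOn unique {x , y} {u , v} p∈ q∈ x∨y≡u∨v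
    with ∈-incomparablePairs⁻ p∈ | ∈-incomparablePairs⁻ q∈
  ... | x<y , x∥y | u<v , u∥v with unique x∥y u∥v x∨y≡u∨v
  ...   | inj₁ (refl , refl) = refl
  ...   | inj₂ (refl , refl) = contradiction u<v (Fin.<-asym x<y)

  injectiveOn⇒uniqueIncomparableJoins : InjectiveOn join incomparablePairs → UniqueIncomparableJoins L
  injectiveOn⇒uniqueIncomparableJoins injective {x} {y} {u} {v} x∥y u∥v x∨y≡u∨v
    with incomparable⇒∈-incomparablePairs x∥y | incomparable⇒∈-incomparablePairs u∥v
  ... | p , p∈ , p≡ | q , q∈ , q≡ =
    same-pair p≡ q≡ (injective p∈ q∈ (trans (join-of-ordering p≡) (trans x∨y≡u∨v (sym (join-of-ordering q≡)))))
    where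
    same-pair : ∀ {p q} → p ≡ (x , y) ⊎ p ≡ (y , x) → q ≡ (u , v) ⊎ q ≡ (v , u) → p ≡ q →
                (x ≡ u × y ≡ v) ⊎ (x ≡ v × y ≡ u)
    same-pair (inj₁ refl) (inj₁ refl) refl = inj₁ (refl , refl)
    same-pair (inj₁ refl) (inj₂ refl) refl = inj₂ (refl , refl)
    same-pair (inj₂ refl) (inj₁ refl) refl = inj₂ (refl , refl)
    same-pair (inj₂ refl) (inj₂ refl) refl = inj₁ (refl , refl)

  count⇔uniqueIncomparableJoins : nIncomparable L ≡ n ∸ numJ L ⇔ UniqueIncomparableJoins L
  count⇔uniqueIncomparableJoins = mk⇔ count⇒unique unique⇒count
    where
    open ≤-Reasoning
    unique-incomparablePairs : Unique incomparablePairs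
    unique-incomparablePairs = filter⁺ (incomparablePair? L) (cartesianProduct⁺ (allFin⁺ n) (allFin⁺ n))
    unique-joinReducibles : Unique joinReducibles
    unique-joinReducibles = filter⁺ (¬? ∘ joinIrreducible? L) (allFin⁺ n)

    count⇒unique : nIncomparable L ≡ n ∸ numJ L → UniqueIncomparableJoins L
    count⇒unique count = injectiveOn⇒uniqueIncomparableJoins
      (onto-shorter⇒InjectiveOn join (≡-dec _≟_ _≟_) _≟_ unique-joinReducibles joinReducibles⊆joins
        (≤-reflexive (trans count (sym length-joinReducibles))))

    unique⇒count : UniqueIncomparableJoins L → nIncomparable L ≡ n ∸ numJ L
    unique⇒count unique = trans (≤-antisym
      (begin
        length incomparablePairs            ≡⟨ length-map join incomparablePairs ⟨
        length (map join incomparablePairs) ≤⟨ Unique-⊆⇒length≤ _≟_ unique-joins joins⊆joinReducibles ⟩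
        length joinReducibles               ∎)
      (begin
        length joinReducibles               ≤⟨ Unique-⊆⇒length≤ _≟_ unique-joinReducibles joinReducibles⊆joins ⟩
        length (map join incomparablePairs) ≡⟨ length-map join incomparablePairs ⟩
        length incomparablePairs            ∎))
      length-joinReducibles
      where
      unique-joins : Unique (map join incomparablePairs)
      unique-joins = Unique-map⁺ join (uniqueIncomparableJoins⇒injectiveOn unique) unique-incomparablePairs

module _ (P : BPoset) where
  open BPoset P

  Equivalent : Carrier → Carrier → Set
  Equivalent x y = x ≼ y × y ≼ x

  record IsBoundedPreorder : Set where
    field
      ≼-refl  : ∀ x → x ≼ x
      ≼-trans : ∀ {x y z} → x ≼ y → y ≼ z → x ≼ z
      bot-≼   : ∀ x → bot ≼ x
      ≼-top   : ∀ x → x ≼ top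

    Equivalent-refl : ∀ {x} → Equivalent x x
    Equivalent-refl = ≼-refl _ , ≼-refl _

  Unrelated : Carrier → Carrier → Set
  Unrelated x y = ¬ x ≼ y × ¬ y ≼ x

  UpperBound : Carrier → Carrier → Carrier → Set
  UpperBound x y w = x ≼ w × y ≼ w

  -- The order-theoretic form of UniqueIncomparableJoins: a preorder need not have joins.
  UniqueUnrelatedSups : Set
  UniqueUnrelatedSups = ∀ {x y u v} → Unrelated x y → Unrelated u v →
    (∀ w → UpperBound x y w ⇔ UpperBound u v w) →
    (Equivalent x u × Equivalent y v) ⊎ (Equivalent x v × Equivalent y u)


chain-isBoundedPreorder : ∀ k → IsBoundedPreorder (chain k)
chain-isBoundedPreorder k = record
  { ≼-refl = λ _ → Fin.≤-refl ; ≼-trans = Fin.≤-trans ; bot-≼ = λ _ → z≤n ; ≼-top = Fin.≤fromℕ }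

chain-uniqueUnrelatedSups : ∀ k → UniqueUnrelatedSups (chain k)
chain-uniqueUnrelatedSups k {x} {y} (x⋠y , y⋠x) _ _ with Fin.≤-total x y
... | inj₁ x≼y = contradiction x≼y x⋠y
... | inj₂ y≼x = contradiction y≼x y⋠x

diamond-isBoundedPreorder : IsBoundedPreorder diamond
diamond-isBoundedPreorder = record
  { ≼-refl  = λ _ → Bool.≤-refl , Bool.≤-refl
  ; ≼-trans = λ (p , q) (p′ , q′) → Bool.≤-trans p p′ , Bool.≤-trans q q′
  ; bot-≼   = λ (p , q) → Bool.≤-minimum p , Bool.≤-minimum q
  ; ≼-top   = λ (p , q) → Bool.≤-maximum p , Bool.≤-maximum q
  }

private module Diamond = IsBoundedPreorder diamond-isBoundedPreorder

diamond-unrelated : ∀ {x y} → Unrelated diamond x y →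
  (x ≡ (true , false) × y ≡ (false , true)) ⊎ (x ≡ (false , true) × y ≡ (true , false))
diamond-unrelated {true  , false} {false , true } _ = inj₁ (refl , refl)
diamond-unrelated {false , true } {true  , false} _ = inj₂ (refl , refl)
diamond-unrelated {false , false} {y}         (x⋠y , _) = contradiction (Diamond.bot-≼ y) x⋠y
diamond-unrelated {x}         {false , false} (_ , y⋠x) = contradiction (Diamond.bot-≼ x) y⋠x
diamond-unrelated {true  , true } {y}         (_ , y⋠x) = contradiction (Diamond.≼-top y) y⋠x
diamond-unrelated {x}         {true  , true } (x⋠y , _) = contradiction (Diamond.≼-top x) x⋠y
diamond-unrelated {true  , false} {true  , false} (x⋠y , _) = contradiction (Diamond.≼-refl _) x⋠y
diamond-unrelated {false , true } {false , true } (x⋠y , _) = contradiction (Diamond.≼-refl _) x⋠y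

diamond-uniqueUnrelatedSups : UniqueUnrelatedSups diamond
diamond-uniqueUnrelatedSups x∥y u∥v _ with diamond-unrelated x∥y | diamond-unrelated u∥v
... | inj₁ (refl , refl) | inj₁ (refl , refl) = inj₁ (Diamond.Equivalent-refl , Diamond.Equivalent-refl)
... | inj₁ (refl , refl) | inj₂ (refl , refl) = inj₂ (Diamond.Equivalent-refl , Diamond.Equivalent-refl)
... | inj₂ (refl , refl) | inj₁ (refl , refl) = inj₂ (Diamond.Equivalent-refl , Diamond.Equivalent-refl)
... | inj₂ (refl , refl) | inj₂ (refl , refl) = inj₁ (Diamond.Equivalent-refl , Diamond.Equivalent-refl)

module _ {Q P : BPoset} (f : BPoset.Carrier Q → BPoset.Carrier P)
         (mono : ∀ {x y} → BPoset._≼_ Q x y → BPoset._≼_ P (f x) (f y))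
         (reflect : ∀ {x y} → BPoset._≼_ P (f x) (f y) → BPoset._≼_ Q x y) where

  embedding-uniqueUnrelatedSups : UniqueUnrelatedSups Q → ∀ {x y u v} →
    Unrelated P (f x) (f y) → Unrelated P (f u) (f v) →
    (∀ w → UpperBound P (f x) (f y) w ⇔ UpperBound P (f u) (f v) w) →
    (Equivalent P (f x) (f u) × Equivalent P (f y) (f v)) ⊎ (Equivalent P (f x) (f v) × Equivalent P (f y) (f u))
  embedding-uniqueUnrelatedSups U (fx⋠fy , fy⋠fx) (fu⋠fv , fv⋠fu) same
    with U (fx⋠fy ∘ mono , fy⋠fx ∘ mono) (fu⋠fv ∘ mono , fv⋠fu ∘ mono) (λ w → mk⇔
           (λ (x≼w , y≼w) → let fu≼fw , fv≼fw = Equivalence.to   (same (f w)) (mono x≼w , mono y≼w)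
                            in reflect fu≼fw , reflect fv≼fw)
           (λ (u≼w , v≼w) → let fx≼fw , fy≼fw = Equivalence.from (same (f w)) (mono u≼w , mono v≼w)
                            in reflect fx≼fw , reflect fy≼fw))
  ... | inj₁ ((x≼u , u≼x) , (y≼v , v≼y)) = inj₁ ((mono x≼u , mono u≼x) , (mono y≼v , mono v≼y))
  ... | inj₂ ((x≼v , v≼x) , (y≼u , u≼y)) = inj₂ ((mono x≼v , mono v≼x) , (mono y≼u , mono u≼y))

module _ {L₁ L₂ : BPoset} where
  open BPoset

  ConcatLe-inj₁ : ∀ {x y} → ConcatLe L₁ L₂ (inj₁ x) (inj₁ y) → _≼_ L₁ x y
  ConcatLe-inj₁ (le₁₁ x≼y) = x≼y

  ConcatLe-inj₂ : ∀ {x y} → ConcatLe L₁ L₂ (inj₂ x) (inj₂ y) → _≼_ L₂ x y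
  ConcatLe-inj₂ (le₂₂ x≼y) = x≼y

  ConcatLe-inj₂-inj₁ : ∀ {x y} → ConcatLe L₁ L₂ (inj₂ x) (inj₁ y) →
                       _≼_ L₂ x (bot L₂) × _≼_ L₁ (top L₁) y
  ConcatLe-inj₂-inj₁ (le₂₁ x≼bot top≼y) = x≼bot , top≼y

  module _ (B₁ : IsBoundedPreorder L₁) (B₂ : IsBoundedPreorder L₂) where
    private
      module B₁ = IsBoundedPreorder B₁
      module B₂ = IsBoundedPreorder B₂

    #-isBoundedPreorder : IsBoundedPreorder (L₁ # L₂)
    #-isBoundedPreorder = record
      { ≼-refl  = λ { (inj₁ x) → le₁₁ (B₁.≼-refl x) ; (inj₂ x) → le₂₂ (B₂.≼-refl x) }
      ; ≼-trans = ≼-trans′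
      ; bot-≼   = λ { (inj₁ x) → le₁₁ (B₁.bot-≼ x) ; (inj₂ x) → le₁₂ }
      ; ≼-top   = λ { (inj₁ x) → le₁₂ ; (inj₂ x) → le₂₂ (B₂.≼-top x) }
      }
      where
      ≼-trans′ : ∀ {x y z} → ConcatLe L₁ L₂ x y → ConcatLe L₁ L₂ y z → ConcatLe L₁ L₂ x z
      ≼-trans′ (le₁₁ x≼y)        (le₁₁ y≼z)        = le₁₁ (B₁.≼-trans x≼y y≼z)
      ≼-trans′ (le₁₁ _)          le₁₂              = le₁₂
      ≼-trans′ le₁₂              (le₂₂ _)          = le₁₂
      ≼-trans′ {inj₁ x} le₁₂     (le₂₁ _ top≼z)    = le₁₁ (B₁.≼-trans (B₁.≼-top x) top≼z)
      ≼-trans′ (le₂₂ x≼y)        (le₂₂ y≼z)        = le₂₂ (B₂.≼-trans x≼y y≼z)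
      ≼-trans′ (le₂₂ x≼y)        (le₂₁ y≼bot top≼z) = le₂₁ (B₂.≼-trans x≼y y≼bot) top≼z
      ≼-trans′ (le₂₁ x≼bot top≼y) (le₁₁ y≼z)       = le₂₁ x≼bot (B₁.≼-trans top≼y y≼z)
      ≼-trans′ (le₂₁ x≼bot _)    (le₁₂ {y = z})    = le₂₂ (B₂.≼-trans x≼bot (B₂.bot-≼ z))

    top₁-not-upperBound : ∀ {u v} → Unrelated (L₁ # L₂) (inj₂ u) (inj₂ v) →
                ¬ UpperBound (L₁ # L₂) (inj₂ u) (inj₂ v) (inj₁ (top L₁))
    top₁-not-upperBound (u⋠v , _) (u≼top , _) =
      u⋠v (le₂₂ (B₂.≼-trans (proj₁ (ConcatLe-inj₂-inj₁ u≼top)) (B₂.bot-≼ _)))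

    -- Unrelated pairs lie within one summand, and two pairs in different summands are separated by the
    -- upper bound inj₁ (top L₁) of the lower one.
    #-uniqueUnrelatedSups : UniqueUnrelatedSups L₁ → UniqueUnrelatedSups L₂ → UniqueUnrelatedSups (L₁ # L₂)
    #-uniqueUnrelatedSups U₁ U₂ {inj₁ x} {inj₂ y} (x⋠y , _) _ _ = contradiction le₁₂ x⋠y
    #-uniqueUnrelatedSups U₁ U₂ {inj₂ x} {inj₁ y} (_ , y⋠x) _ _ = contradiction le₁₂ y⋠x
    #-uniqueUnrelatedSups U₁ U₂ {u = inj₁ u} {inj₂ v} _ (u⋠v , _) _ = contradiction le₁₂ u⋠v
    #-uniqueUnrelatedSups U₁ U₂ {u = inj₂ u} {inj₁ v} _ (_ , v⋠u) _ = contradiction le₁₂ v⋠u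
    #-uniqueUnrelatedSups U₁ U₂ {inj₁ x} {inj₁ y} {inj₂ u} {inj₂ v} _ u∥v same =
      ⊥-elim $ top₁-not-upperBound u∥v $
        Equivalence.to (same (inj₁ (top L₁))) (le₁₁ (B₁.≼-top x) , le₁₁ (B₁.≼-top y))
    #-uniqueUnrelatedSups U₁ U₂ {inj₂ x} {inj₂ y} {inj₁ u} {inj₁ v} x∥y _ same =
      ⊥-elim $ top₁-not-upperBound x∥y $
        Equivalence.from (same (inj₁ (top L₁))) (le₁₁ (B₁.≼-top u) , le₁₁ (B₁.≼-top v))
    #-uniqueUnrelatedSups U₁ U₂ {inj₁ _} {inj₁ _} {inj₁ _} {inj₁ _} =
      embedding-uniqueUnrelatedSups {Q = L₁} {P = L₁ # L₂} inj₁ le₁₁ ConcatLe-inj₁ U₁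
    #-uniqueUnrelatedSups U₁ U₂ {inj₂ _} {inj₂ _} {inj₂ _} {inj₂ _} =
      embedding-uniqueUnrelatedSups {Q = L₂} {P = L₁ # L₂} inj₂ le₂₂ ConcatLe-inj₂ U₂

piece-isBoundedPreorder : ∀ p → IsBoundedPreorder ⟦ p ⟧
piece-isBoundedPreorder dia     = diamond-isBoundedPreorder
piece-isBoundedPreorder (chn k) = chain-isBoundedPreorder k

piece-uniqueUnrelatedSups : ∀ p → UniqueUnrelatedSups ⟦ p ⟧
piece-uniqueUnrelatedSups dia     = diamond-uniqueUnrelatedSups
piece-uniqueUnrelatedSups (chn k) = chain-uniqueUnrelatedSups k

concatAll-isBoundedPreorder : ∀ {M Ms} → IsBoundedPreorder M → All IsBoundedPreorder Ms →
                              IsBoundedPreorder (concatAll M Ms)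
concatAll-isBoundedPreorder B []         = B
concatAll-isBoundedPreorder B (B′ ∷ Bs) = #-isBoundedPreorder B (concatAll-isBoundedPreorder B′ Bs)

concatAll-uniqueUnrelatedSups : ∀ {M Ms} → IsBoundedPreorder M → All IsBoundedPreorder Ms →
  UniqueUnrelatedSups M → All UniqueUnrelatedSups Ms → UniqueUnrelatedSups (concatAll M Ms)
concatAll-uniqueUnrelatedSups B []         U []         = U
concatAll-uniqueUnrelatedSups B (B′ ∷ Bs) U (U′ ∷ Us) =
  #-uniqueUnrelatedSups B (concatAll-isBoundedPreorder B′ Bs) U (concatAll-uniqueUnrelatedSups B′ Bs U′ Us)

concatPieces-isBoundedPreorder : ∀ ps → IsBoundedPreorder (concatPieces ps)
concatPieces-isBoundedPreorder (p ∷ ps) =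
  concatAll-isBoundedPreorder (piece-isBoundedPreorder p) (All-map⁺ (All.universal piece-isBoundedPreorder ps))

concatPieces-uniqueUnrelatedSups : ∀ ps → UniqueUnrelatedSups (concatPieces ps)
concatPieces-uniqueUnrelatedSups (p ∷ ps) =
  concatAll-uniqueUnrelatedSups (piece-isBoundedPreorder p) (All-map⁺ (All.universal piece-isBoundedPreorder ps))
    (piece-uniqueUnrelatedSups p) (All-map⁺ (All.universal piece-uniqueUnrelatedSups ps))

module _ {n : ℕ} {L : FinDistLattice n} {P : BPoset} (B : IsBoundedPreorder P) (iso : L ≅ P) where
  open LatticeProperties L
  open IsBoundedPreorder B
  open _≅_ iso
  open BPoset P using (_≼_)

  private
    to-≤ : ∀ {x y} → x ≤ y → to x ≼ to y
    to-≤ = Equivalence.to (to-mono _ _)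

    to-≼ : ∀ {x y} → to x ≼ to y → x ≤ y
    to-≼ = Equivalence.from (to-mono _ _)

    ≼⇒≤-from : ∀ {x w} → to x ≼ w → x ≤ from w
    ≼⇒≤-from x≼w = to-≼ (≼-trans x≼w (proj₂ (to-from _)))

    ≤-from⇒≼ : ∀ {x w} → x ≤ from w → to x ≼ w
    ≤-from⇒≼ x≤w = ≼-trans (to-≤ x≤w) (proj₁ (to-from _))

    upperBound-of-join : ∀ {x y u v} → x ∨ y ≡ u ∨ v →
                         ∀ w → UpperBound P (to x) (to y) w → UpperBound P (to u) (to v) w
    upperBound-of-join {x} {y} {u} {v} x∨y≡u∨v w (x≼w , y≼w) =
      ≤-from⇒≼ (≤-trans (x≤x∨y u v) u∨v≤w) , ≤-from⇒≼ (≤-trans (y≤x∨y u v) u∨v≤w)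
      where
      u∨v≤w : (u ∨ v) ≤ from w
      u∨v≤w = subst (_≤ from w) x∨y≡u∨v (∨-least (≼⇒≤-from x≼w) (≼⇒≤-from y≼w))

    equivalent⇒≡ : ∀ {x y} → Equivalent P (to x) (to y) → x ≡ y
    equivalent⇒≡ (x≼y , y≼x) = antisym (to-≼ x≼y) (to-≼ y≼x)

  ≅-uniqueIncomparableJoins : UniqueUnrelatedSups P → UniqueIncomparableJoins L
  ≅-uniqueIncomparableJoins U (x≰y , y≰x) (u≰v , v≰u) x∨y≡u∨v
    with U (x≰y ∘ to-≼ , y≰x ∘ to-≼) (u≰v ∘ to-≼ , v≰u ∘ to-≼)
           (λ w → mk⇔ (upperBound-of-join x∨y≡u∨v w) (upperBound-of-join (sym x∨y≡u∨v) w))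
  ... | inj₁ (x≈u , y≈v) = inj₁ (equivalent⇒≡ x≈u , equivalent⇒≡ y≈v)
  ... | inj₂ (x≈v , y≈u) = inj₂ (equivalent⇒≡ x≈v , equivalent⇒≡ y≈u)

module Covers {n : ℕ} (L : FinDistLattice n) where
  open LatticeProperties L
  open import Data.Nat using () renaming (_<_ to _<ℕ_)

  infix 4 _⋖_
  record _⋖_ (m c : Fin n) : Set where
    field
      m≤c        : m ≤ c
      m≢c        : m ≢ c
      no-between : ∀ {z} → m ≤ z → z ≤ c → z ≡ m ⊎ z ≡ c
  open _⋖_ public

  ↑_ ↓_ : Fin n → List (Fin n)
  ↑ x = filter (x ≤?_) (allFin n)
  ↓ x = filter (_≤? x) (allFin n)

  length-↑-< : ∀ {x y} → x ≤ y → x ≢ y → length (↑ y) <ℕ length (↑ x)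
  length-↑-< {x} {y} x≤y x≢y = filter-⊂⇒length< _≟_ (y ≤?_) (x ≤?_) (allFin⁺ n) (≤-trans x≤y)
    (∈-allFin x) ≤-refl (λ y≤x → x≢y (antisym x≤y y≤x))

  length-↓-< : ∀ {x y} → x ≤ y → x ≢ y → length (↓ x) <ℕ length (↓ y)
  length-↓-< {x} {y} x≤y x≢y = filter-⊂⇒length< _≟_ (_≤? x) (_≤? y) (allFin⁺ n)
    (λ z≤x → ≤-trans z≤x x≤y) (∈-allFin y) ≤-refl (λ y≤x → x≢y (antisym x≤y y≤x))

  cover-below : ∀ {m x} → m ≤ x → m ≢ x → ∃ λ c → m ⋖ c × c ≤ x
  cover-below {m} {x} = go x (On.wellFounded (length ∘ ↓_) <-wellFounded x)
    where
    go : ∀ x → Acc (_<ℕ_ on (length ∘ ↓_)) x → m ≤ x → m ≢ x → ∃ λ c → m ⋖ c × c ≤ x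
    go x (acc rec) m≤x m≢x
      with Fin.any? (λ z → (m ≤? z) ×-dec (¬? (m ≟ z) ×-dec ((z ≤? x) ×-dec ¬? (z ≟ x))))
    ... | yes (z , m≤z , m≢z , z≤x , z≢x) =
      let c , m⋖c , c≤z = go z (rec (length-↓-< z≤x z≢x)) m≤z m≢z in c , m⋖c , ≤-trans c≤z z≤x
    ... | no none = x , record { m≤c = m≤x ; m≢c = m≢x ; no-between = between } , ≤-refl
      where
      between : ∀ {z} → m ≤ z → z ≤ x → z ≡ m ⊎ z ≡ x
      between {z} m≤z z≤x with z ≟ m | z ≟ x
      ... | yes z≡m | _       = inj₁ z≡m
      ... | no  _   | yes z≡x = inj₂ z≡x
      ... | no  z≢m | no  z≢x = contradiction (z , m≤z , z≢m ∘ sym , z≤x , z≢x) none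

  data Shape (m : Fin n) : Set where
    maximal      : (∀ {y} → m ≤ y → y ≡ m) → Shape m
    single-cover : ∀ {a} → m ⋖ a → (∀ {y} → m ≤ y → y ≡ m ⊎ a ≤ y) → Shape m
    two-covers   : ∀ {a b} → m ⋖ a → m ⋖ b → a ≢ b → Shape m

  shape : ∀ m → Shape m
  shape m with Fin.any? (λ y → (m ≤? y) ×-dec ¬? (y ≟ m))
  ... | no none = maximal λ {y} m≤y → decidable-stable (y ≟ m) (λ y≢m → none (y , m≤y , y≢m))
  ... | yes (y , m≤y , y≢m) with cover-below m≤y (y≢m ∘ sym)
  ...   | a , m⋖a , _ with Fin.any? (λ z → (m ≤? z) ×-dec (¬? (z ≟ m) ×-dec ¬? (a ≤? z)))
  ...     | no none = single-cover m⋖a above-m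
    where
    above-m : ∀ {z} → m ≤ z → z ≡ m ⊎ a ≤ z
    above-m {z} m≤z with z ≟ m
    ... | yes z≡m = inj₁ z≡m
    ... | no  z≢m = inj₂ (decidable-stable (a ≤? z) (λ a≰z → none (z , m≤z , z≢m , a≰z)))
  ...     | yes (z , m≤z , z≢m , a≰z) with cover-below m≤z (z≢m ∘ sym)
  ...       | b , m⋖b , b≤z = two-covers m⋖a m⋖b λ { refl → a≰z b≤z }

  module _ {m : Fin n} where

    covers-incomparable : ∀ {a b} → m ⋖ a → m ⋖ b → a ≢ b → a ∥ b
    covers-incomparable m⋖a m⋖b a≢b =
      (λ a≤b → [ m⋖a .m≢c ∘ sym , a≢b ] (m⋖b .no-between (m⋖a .m≤c) a≤b)) ,
      (λ b≤a → [ m⋖b .m≢c ∘ sym , a≢b ∘ sym ] (m⋖a .no-between (m⋖b .m≤c) b≤a))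

    ⋖-meet : ∀ {a x} → m ⋖ a → m ≤ x → ¬ a ≤ x → x ∧ a ≡ m
    ⋖-meet {a} {x} m⋖a m≤x a≰x with m⋖a .no-between (∧-greatest m≤x (m⋖a .m≤c)) (x∧y≤y x a)
    ... | inj₁ x∧a≡m = x∧a≡m
    ... | inj₂ x∧a≡a = contradiction (subst (_≤ x) x∧a≡a (x∧y≤x x a)) a≰x

    ⋖-meet-∨ : ∀ {a b x} → m ⋖ a → m ⋖ b → m ≤ x → ¬ a ≤ x → ¬ b ≤ x → x ∧ (a ∨ b) ≡ m
    ⋖-meet-∨ {a} {b} {x} m⋖a m⋖b m≤x a≰x b≰x = begin
      x ∧ (a ∨ b)       ≡⟨ ∧-distribˡ-∨ x a b ⟩
      (x ∧ a) ∨ (x ∧ b) ≡⟨ cong₂ _∨_ (⋖-meet m⋖a m≤x a≰x) (⋖-meet m⋖b m≤x b≰x) ⟩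
      m ∨ m             ≡⟨ ∨-idempotent m ⟩
      m                 ∎
      where open ≡-Reasoning

    join-of-covers∥cover : ∀ {a b c} → m ⋖ a → m ⋖ b → m ⋖ c → a ≢ c → b ≢ c → (a ∨ b) ∥ c
    join-of-covers∥cover {a} {b} {c} m⋖a m⋖b m⋖c a≢c b≢c =
      (λ a∨b≤c → a≰c (≤-trans (x≤x∨y a b) a∨b≤c)) ,
      (λ c≤a∨b → m⋖c .m≢c (trans (sym (⋖-meet-∨ m⋖a m⋖b (m⋖c .m≤c) a≰c b≰c)) (x≤y⇒x∧y≡x c≤a∨b)))
      where
      a≰c = proj₁ (covers-incomparable m⋖a m⋖c a≢c)
      b≰c = proj₁ (covers-incomparable m⋖b m⋖c b≢c)

    below-join-of-covers : ∀ {a b y} → m ⋖ a → m ⋖ b → a ≤ y → y ≤ (a ∨ b) → ¬ b ≤ y → y ≡ a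
    below-join-of-covers {a} {b} {y} m⋖a m⋖b a≤y y≤a∨b b≰y = begin
      y                 ≡⟨ ≤∨⇒≡∧∨∧ y≤a∨b ⟩
      (y ∧ a) ∨ (y ∧ b) ≡⟨ cong₂ _∨_ (y≤x⇒x∧y≈y a≤y) (⋖-meet m⋖b (≤-trans (m⋖a .m≤c) a≤y) b≰y) ⟩
      a ∨ m             ≡⟨ ∨-comm a m ⟩
      m ∨ a             ≡⟨ x≤y⇒x∨y≈y (m⋖a .m≤c) ⟩
      a                 ∎
      where open ≡-Reasoning

  module _ (unique : UniqueIncomparableJoins L) {m : Fin n} where

    -- (a ∨ b) ∨ c = (a ∨ c) ∨ b would be two different incomparable splittings.
    no-third-cover : ∀ {a b c} → m ⋖ a → m ⋖ b → m ⋖ c → a ≢ b → a ≢ c → b ≢ c → ⊥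
    no-third-cover {a} {b} {c} m⋖a m⋖b m⋖c a≢b a≢c b≢c
      with unique (join-of-covers∥cover m⋖a m⋖b m⋖c a≢c b≢c)
                  (join-of-covers∥cover m⋖a m⋖c m⋖b a≢b (b≢c ∘ sym))
                  (trans (∨-assoc a b c) (trans (cong (a ∨_) (∨-comm b c)) (sym (∨-assoc a c b))))
    ... | inj₁ (_ , c≡b)   = b≢c (sym c≡b)
    ... | inj₂ (a∨b≡b , _) = proj₁ (covers-incomparable m⋖a m⋖b a≢b) (subst (a ≤_) a∨b≡b (x≤x∨y a b))

    -- Otherwise y ∨ b = y ∨ (a ∨ b) would be two different incomparable splittings.
    above-cover⇒above-other : ∀ {a b y} → m ⋖ a → m ⋖ b → a ≢ b → a ≤ y → y ≢ a → b ≤ y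
    above-cover⇒above-other {a} {b} {y} m⋖a m⋖b a≢b a≤y y≢a =
      decidable-stable (b ≤? y) λ b≰y → splittings-differ b≰y (unique (y∥b b≰y) (y∥a∨b b≰y) joins-equal)
      where
      a≰b = proj₁ (covers-incomparable m⋖a m⋖b a≢b)
      y∥b : ¬ b ≤ y → y ∥ b
      y∥b b≰y = (λ y≤b → a≰b (≤-trans a≤y y≤b)) , b≰y
      y∥a∨b : ¬ b ≤ y → y ∥ (a ∨ b)
      y∥a∨b b≰y = (λ y≤a∨b → y≢a (below-join-of-covers m⋖a m⋖b a≤y y≤a∨b b≰y)) ,
                  (λ a∨b≤y → b≰y (≤-trans (y≤x∨y a b) a∨b≤y))
      joins-equal : y ∨ b ≡ y ∨ (a ∨ b)
      joins-equal = sym (trans (sym (∨-assoc y a b)) (cong (_∨ b) (trans (∨-comm y a) (x≤y⇒x∨y≈y a≤y))))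
      splittings-differ : ¬ b ≤ y → (y ≡ y × b ≡ a ∨ b) ⊎ (y ≡ a ∨ b × b ≡ y) → ⊥
      splittings-differ _   (inj₁ (_ , b≡a∨b)) = a≰b (subst (a ≤_) (sym b≡a∨b) (x≤x∨y a b))
      splittings-differ b≰y (inj₂ (_ , b≡y))   = b≰y (subst (b ≤_) b≡y ≤-refl)

    above-cover⇒comparable : ∀ {a b y} → m ⋖ a → m ⋖ b → a ≢ b → a ≤ y → y ≤ (a ∨ b) ⊎ (a ∨ b) ≤ y
    above-cover⇒comparable {a} {b} {y} m⋖a m⋖b a≢b a≤y with y ≟ a
    ... | yes refl = inj₁ (x≤x∨y a b)
    ... | no  y≢a  = inj₂ (∨-least a≤y (above-cover⇒above-other m⋖a m⋖b a≢b a≤y y≢a))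

    comparable-with-join-of-covers : ∀ {a b y} → m ⋖ a → m ⋖ b → a ≢ b → m ≤ y →
                                     y ≤ (a ∨ b) ⊎ (a ∨ b) ≤ y
    comparable-with-join-of-covers {a} {b} {y} m⋖a m⋖b a≢b m≤y with y ≟ m
    ... | yes refl = inj₁ (≤-trans (m⋖a .m≤c) (x≤x∨y a b))
    ... | no  y≢m with cover-below m≤y (y≢m ∘ sym)
    ...   | c , m⋖c , c≤y with c ≟ a | c ≟ b
    ...     | yes refl | _        = above-cover⇒comparable m⋖a m⋖b a≢b c≤y
    ...     | no  _    | yes refl =
      subst (λ t → y ≤ t ⊎ t ≤ y) (∨-comm b a) (above-cover⇒comparable m⋖b m⋖a (a≢b ∘ sym) c≤y)
    ...     | no  c≢a  | no  c≢b  = ⊥-elim (no-third-cover m⋖a m⋖b m⋖c a≢b (c≢a ∘ sym) (c≢b ∘ sym))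

record _↾_≅_ {n : ℕ} (L : FinDistLattice n) (S : Fin n → Set) (P : BPoset) : Set where
  field
    to      : Fin n → BPoset.Carrier P
    from    : BPoset.Carrier P → Fin n
    from-∈  : ∀ c → S (from c)
    to-mono : ∀ {x y} → S x → S y → FinDistLattice._≤_ L x y ⇔ BPoset._≼_ P (to x) (to y)
    from-to : ∀ {x} → S x → from (to x) ≡ x
    to-from : ∀ c → Equivalent P (to (from c)) c

module _ {n : ℕ} {L : FinDistLattice n} {S : Fin n → Set} {P : BPoset} (iso : L ↾ S ≅ P) where
  open LatticeProperties L
  open _↾_≅_ iso
  open BPoset P using (_≼_; bot; top)

  ↾-≅ : (∀ x → S x) → L ≅ P
  ↾-≅ all-S = record
    { to      = to
    ; from    = from
    ; to-mono = λ x y → to-mono (all-S x) (all-S y)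
    ; from-to = λ x → from-to (all-S x)
    ; to-from = to-from
    }

  module _ (B : IsBoundedPreorder P) where
    open IsBoundedPreorder B

    ↾-to-least : ∀ {m} → S m → (∀ {x} → S x → m ≤ x) → Equivalent P (to m) bot
    ↾-to-least S-m least =
      ≼-trans (Equivalence.to (to-mono S-m (from-∈ bot)) (least (from-∈ bot))) (proj₁ (to-from bot)) , bot-≼ _

    ↾-to-greatest : ∀ {t} → S t → (∀ {x} → S x → x ≤ t) → Equivalent P (to t) top
    ↾-to-greatest S-t greatest =
      ≼-top _ , ≼-trans (proj₂ (to-from top)) (Equivalence.to (to-mono (from-∈ top) S-t) (greatest (from-∈ top)))

Interval : ∀ {n} → FinDistLattice n → Fin n → Fin n → Fin n → Set
Interval L m t x = FinDistLattice._≤_ L m x × FinDistLattice._≤_ L x t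

module Glue {n : ℕ} {L : FinDistLattice n} {m t : Fin n} {D P : BPoset}
            (B-D : IsBoundedPreorder D) (B-P : IsBoundedPreorder P)
            (m≤t : FinDistLattice._≤_ L m t)
            (comparable : ∀ {y} → FinDistLattice._≤_ L m y → FinDistLattice._≤_ L y t ⊎ FinDistLattice._≤_ L t y)
            (lower : L ↾ Interval L m t ≅ D) (upper : L ↾ FinDistLattice._≤_ L t ≅ P) where
  open LatticeProperties L
  open BPoset using (Carrier; _≼_; bot; top)
  private
    module D = IsBoundedPreorder B-D
    module P = IsBoundedPreorder B-P
    module I = _↾_≅_ lower
    module U = _↾_≅_ upper

  above : ∀ {y} → m ≤ y → ¬ y ≤ t → t ≤ y
  above m≤y y≰t = [ (λ y≤t → contradiction y≤t y≰t) , (λ t≤y → t≤y) ] (comparable m≤y)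

  upper-to-t≈bot : Equivalent P (U.to t) (bot P)
  upper-to-t≈bot = ↾-to-least upper B-P ≤-refl (λ t≤x → t≤x)

  top≼lower-to-t : _≼_ D (top D) (I.to t)
  top≼lower-to-t = proj₂ (↾-to-greatest lower B-D (m≤t , ≤-refl) proj₂)

  place : ∀ {y} → Dec (y ≤ t) → Carrier (D # P)
  place {y} (yes _) = inj₁ (I.to y)
  place {y} (no  _) = inj₂ (U.to y)

  from : Carrier (D # P) → Fin n
  from (inj₁ c) = I.from c
  from (inj₂ c) = U.from c

  from-∈ : ∀ c → m ≤ from c
  from-∈ (inj₁ c) = proj₁ (I.from-∈ c)
  from-∈ (inj₂ c) = ≤-trans m≤t (U.from-∈ c)

  place-mono : ∀ {x y} → m ≤ x → m ≤ y → (x≤?t : Dec (x ≤ t)) (y≤?t : Dec (y ≤ t)) →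
               x ≤ y ⇔ ConcatLe D P (place x≤?t) (place y≤?t)
  place-mono m≤x m≤y (yes x≤t) (yes y≤t) =
    mk⇔ (le₁₁ ∘ Equivalence.to I-mono) (Equivalence.from I-mono ∘ ConcatLe-inj₁)
    where I-mono = I.to-mono (m≤x , x≤t) (m≤y , y≤t)
  place-mono m≤x m≤y (yes x≤t) (no  y≰t) = mk⇔ (λ _ → le₁₂) (λ _ → ≤-trans x≤t (above m≤y y≰t))
  place-mono m≤x m≤y (no  x≰t) (yes y≤t) = mk⇔
    (λ x≤y → contradiction (≤-trans x≤y y≤t) x≰t)
    (λ x≼y → contradiction (Equivalence.from (U.to-mono (above m≤x x≰t) ≤-refl)
                             (P.≼-trans (proj₁ (ConcatLe-inj₂-inj₁ x≼y)) (proj₂ upper-to-t≈bot))) x≰t)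
  place-mono m≤x m≤y (no  x≰t) (no  y≰t) =
    mk⇔ (le₂₂ ∘ Equivalence.to U-mono) (Equivalence.from U-mono ∘ ConcatLe-inj₂)
    where U-mono = U.to-mono (above m≤x x≰t) (above m≤y y≰t)

  from-place : ∀ {y} → m ≤ y → (y≤?t : Dec (y ≤ t)) → from (place y≤?t) ≡ y
  from-place m≤y (yes y≤t) = I.from-to (m≤y , y≤t)
  from-place m≤y (no  y≰t) = U.from-to (above m≤y y≰t)

  -- An element c of the upper part with from c ≤ t is its bottom, equivalent to the top of the lower part.
  place-from : ∀ c (from-c≤?t : Dec (from c ≤ t)) → Equivalent (D # P) (place from-c≤?t) c
  place-from (inj₁ c) (yes _)   = le₁₁ (proj₁ (I.to-from c)) , le₁₁ (proj₂ (I.to-from c))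
  place-from (inj₁ c) (no  c≰t) = contradiction (proj₂ (I.from-∈ c)) c≰t
  place-from (inj₂ c) (no  _)   = le₂₂ (proj₁ (U.to-from c)) , le₂₂ (proj₂ (U.to-from c))
  place-from (inj₂ c) (yes c≤t) = le₁₂ , le₂₁
    (P.≼-trans (proj₂ (U.to-from c))
      (P.≼-trans (Equivalence.to (U.to-mono t≤c ≤-refl) c≤t) (proj₁ upper-to-t≈bot)))
    (D.≼-trans top≼lower-to-t
      (Equivalence.to (I.to-mono (m≤t , ≤-refl) (≤-trans m≤t t≤c , c≤t)) t≤c))
    where t≤c = U.from-∈ c

  glued : L ↾ (m ≤_) ≅ (D # P)
  glued = record
    { to      = λ y → place (y ≤? t)
    ; from    = from
    ; from-∈  = from-∈
    ; to-mono = λ {x} {y} m≤x m≤y → place-mono m≤x m≤y (x ≤? t) (y ≤? t)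
    ; from-to = λ {y} m≤y → from-place m≤y (y ≤? t)
    ; to-from = λ c → place-from c (from c ≤? t)
    }

module Intervals {n : ℕ} (L : FinDistLattice n) where
  open LatticeProperties L
  open Covers L

  maximal-↾ : ∀ {m} → (∀ {y} → m ≤ y → y ≡ m) → L ↾ (m ≤_) ≅ chain 0
  maximal-↾ {m} m-maximal = record
    { to      = λ _ → 0F
    ; from    = λ _ → m
    ; from-∈  = λ _ → ≤-refl
    ; to-mono = λ {x} {y} m≤x m≤y → mk⇔ (λ _ → z≤n) (λ _ → subst (_≤ y) (sym (m-maximal m≤x)) m≤y)
    ; from-to = λ m≤x → sym (m-maximal m≤x)
    ; to-from = λ { 0F → z≤n , z≤n }
    }

  module _ {m a : Fin n} (m⋖a : m ⋖ a) where

    ⋖-below : ∀ {x} → Interval L m a x → ¬ a ≤ x → x ≡ m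
    ⋖-below (m≤x , x≤a) a≰x =
      [ (λ x≡m → x≡m) , (λ { refl → contradiction ≤-refl a≰x }) ] (m⋖a .no-between m≤x x≤a)

    ⋖-above : ∀ {x} → Interval L m a x → a ≤ x → x ≡ a
    ⋖-above (_ , x≤a) a≤x = antisym x≤a a≤x

    ⋖-↾ : L ↾ Interval L m a ≅ chain 1
    ⋖-↾ = record
      { to      = λ x → bit (a ≤? x)
      ; from    = from
      ; from-∈  = λ { 0F → ≤-refl , m⋖a .m≤c ; 1F → m⋖a .m≤c , ≤-refl }
      ; to-mono = λ {x} {y} Ix Iy → bit-mono Ix Iy (a ≤? x) (a ≤? y)
      ; from-to = λ {x} Ix → from-bit Ix (a ≤? x)
      ; to-from = λ { 0F → bit-m (a ≤? m) ; 1F → bit-a (a ≤? a) }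
      }
      where
      bit : ∀ {x} → Dec (a ≤ x) → Fin 2
      bit (yes _) = 1F
      bit (no  _) = 0F

      from : Fin 2 → Fin n
      from 0F = m
      from 1F = a

      bit-mono : ∀ {x y} → Interval L m a x → Interval L m a y → (a≤?x : Dec (a ≤ x)) (a≤?y : Dec (a ≤ y)) →
                 x ≤ y ⇔ bit a≤?x ≤ᶠ bit a≤?y
      bit-mono (_ , x≤a) _ (yes a≤x) (yes a≤y) = mk⇔ (λ _ → s≤s z≤n) (λ _ → ≤-trans x≤a a≤y)
      bit-mono _ _ (yes a≤x) (no  a≰y) = mk⇔ (λ x≤y → contradiction (≤-trans a≤x x≤y) a≰y) (λ ())
      bit-mono Ix (m≤y , _) (no a≰x) a≤?y =
        mk⇔ (λ _ → z≤n) (λ _ → subst (_≤ _) (sym (⋖-below Ix a≰x)) m≤y)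

      from-bit : ∀ {x} → Interval L m a x → (a≤?x : Dec (a ≤ x)) → from (bit a≤?x) ≡ x
      from-bit Ix (yes a≤x) = sym (⋖-above Ix a≤x)
      from-bit Ix (no  a≰x) = sym (⋖-below Ix a≰x)

      bit-m : (a≤?m : Dec (a ≤ m)) → Equivalent (chain 1) (bit a≤?m) 0F
      bit-m (yes a≤m) = contradiction (antisym (m⋖a .m≤c) a≤m) (m⋖a .m≢c)
      bit-m (no  _)   = z≤n , z≤n

      bit-a : (a≤?a : Dec (a ≤ a)) → Equivalent (chain 1) (bit a≤?a) 1F
      bit-a (yes _)   = s≤s z≤n , s≤s z≤n
      bit-a (no  a≰a) = contradiction ≤-refl a≰a

  does-mono : ∀ {a x y} → x ≤ y → (a≤?x : Dec (a ≤ x)) (a≤?y : Dec (a ≤ y)) → does a≤?x ≤ᵇ does a≤?y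
  does-mono x≤y (yes a≤x) (yes _)   = b≤b
  does-mono x≤y (yes a≤x) (no  a≰y) = contradiction (≤-trans a≤x x≤y) a≰y
  does-mono x≤y (no  _)   a≤?y      = Bool.≤-minimum _

  module Pick (m : Fin n) where

    pick : Fin n → Bool → Fin n
    pick c true  = c
    pick c false = m

    module _ {c : Fin n} (m≤c : m ≤ c) where

      m≤pick : ∀ p → m ≤ pick c p
      m≤pick true  = m≤c
      m≤pick false = ≤-refl

      pick≤ : ∀ p → pick c p ≤ c
      pick≤ true  = ≤-refl
      pick≤ false = m≤c

      pick-mono : ∀ {p q} → p ≤ᵇ q → pick c p ≤ pick c q
      pick-mono b≤b = ≤-refl
      pick-mono f≤t = m≤c

    ⋖-meet-pick : ∀ {a x} → m ⋖ a → m ≤ x → (a≤?x : Dec (a ≤ x)) → x ∧ a ≡ pick a (does a≤?x)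
    ⋖-meet-pick m⋖a m≤x (yes a≤x) = y≤x⇒x∧y≈y a≤x
    ⋖-meet-pick m⋖a m≤x (no  a≰x) = ⋖-meet m⋖a m≤x a≰x

    does-≤-pick-∨ : ∀ {a c z} → m ⋖ a → m ≤ c → ¬ a ≤ c →
                    ∀ p → z ≡ pick a p ∨ c → (a≤?z : Dec (a ≤ z)) → does a≤?z ≡ p
    does-≤-pick-∨ _   _   _   true  _    (yes _)   = refl
    does-≤-pick-∨ _   _   _   true  refl (no  a≰z) = contradiction (x≤x∨y _ _) a≰z
    does-≤-pick-∨ _   m≤c a≰c false refl (yes a≤z) = contradiction (≤-trans a≤z (∨-least m≤c ≤-refl)) a≰c
    does-≤-pick-∨ _   _   _   false _    (no  _)   = refl

  -- [m, a ∨ b] is {m, a, b, a ∨ b}: x is recovered as (x ∧ a) ∨ (x ∧ b), each meet being m or the cover itself.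
  two-covers-↾ : ∀ {m a b} → m ⋖ a → m ⋖ b → a ≢ b → L ↾ Interval L m (a ∨ b) ≅ diamond
  two-covers-↾ {m} {a} {b} m⋖a m⋖b a≢b = record
    { to      = to
    ; from    = from
    ; from-∈  = λ (p , q) → ≤-trans (m≤pick m≤a p) (x≤x∨y _ _) , ∨-monotonic (pick≤ m≤a p) (pick≤ m≤b q)
    ; to-mono = λ {x} {y} Ix Iy → mk⇔
        (λ x≤y → does-mono x≤y (a ≤? x) (a ≤? y) , does-mono x≤y (b ≤? x) (b ≤? y))
        (λ (p≤p′ , q≤q′) → subst₂ _≤_ (from-to (proj₁ Ix) (proj₂ Ix)) (from-to (proj₁ Iy) (proj₂ Iy))
                             (∨-monotonic (pick-mono m≤a p≤p′) (pick-mono m≤b q≤q′)))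
    ; from-to = λ (m≤x , x≤a∨b) → from-to m≤x x≤a∨b
    ; to-from = λ c → subst (λ c′ → Equivalent diamond (to (from c)) c′) (to-from c) Diamond.Equivalent-refl
    }
    where
    open Pick m
    m≤a = m⋖a .m≤c
    m≤b = m⋖b .m≤c
    a≰b = proj₁ (covers-incomparable m⋖a m⋖b a≢b)
    b≰a = proj₂ (covers-incomparable m⋖a m⋖b a≢b)

    to : Fin n → Bool × Bool
    to x = does (a ≤? x) , does (b ≤? x)

    from : Bool × Bool → Fin n
    from (p , q) = pick a p ∨ pick b q

    from-to : ∀ {x} → m ≤ x → x ≤ (a ∨ b) → from (to x) ≡ x
    from-to {x} m≤x x≤a∨b = sym (begin
      x                 ≡⟨ ≤∨⇒≡∧∨∧ x≤a∨b ⟩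
      (x ∧ a) ∨ (x ∧ b) ≡⟨ cong₂ _∨_ (⋖-meet-pick m⋖a m≤x (a ≤? x)) (⋖-meet-pick m⋖b m≤x (b ≤? x)) ⟩
      from (to x)       ∎)
      where open ≡-Reasoning

    to-from : ∀ c → to (from c) ≡ c
    to-from (p , q) = cong₂ _,_
      (does-≤-pick-∨ m⋖a (m≤pick m≤b q) (λ a≤ → a≰b (≤-trans a≤ (pick≤ m≤b q))) p refl (a ≤? _))
      (does-≤-pick-∨ m⋖b (m≤pick m≤a p) (λ b≤ → b≰a (≤-trans b≤ (pick≤ m≤a p))) q (∨-comm _ _) (b ≤? _))

module Decomposition {n : ℕ} (L : FinDistLattice n) (unique : UniqueIncomparableJoins L) where
  open LatticeProperties L
  open Covers L
  open Intervals L
  open import Data.Nat using () renaming (_<_ to _<ℕ_)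

  private
    stack : ∀ {m t} p → L ↾ Interval L m t ≅ ⟦ p ⟧ → m ≤ t → (∀ {y} → m ≤ y → y ≤ t ⊎ t ≤ y) →
            ∃ (λ ps → L ↾ (t ≤_) ≅ concatPieces ps) → ∃ λ ps → L ↾ (m ≤_) ≅ concatPieces ps
    stack p lower m≤t comparable (ps , upper) =
      p ∷⁺ ps , Glue.glued (piece-isBoundedPreorder p) (concatPieces-isBoundedPreorder ps) m≤t comparable lower upper

  decompose-↑ : ∀ m → ∃ λ ps → L ↾ (m ≤_) ≅ concatPieces ps
  decompose-↑ m = go m (On.wellFounded (length ∘ ↑_) <-wellFounded m)
    where
    go : ∀ m → Acc (_<ℕ_ on (length ∘ ↑_)) m → ∃ λ ps → L ↾ (m ≤_) ≅ concatPieces ps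
    go m (acc rec) with shape m
    ... | maximal m-maximal = (chn 0 ∷ []) , maximal-↾ m-maximal
    ... | single-cover {a} m⋖a above =
      stack (chn 1) (⋖-↾ m⋖a) (m⋖a .m≤c) (map₁ (λ { refl → m⋖a .m≤c }) ∘ above)
        (go a (rec (length-↑-< (m⋖a .m≤c) (m⋖a .m≢c))))
    ... | two-covers {a} {b} m⋖a m⋖b a≢b =
      stack dia (two-covers-↾ m⋖a m⋖b a≢b) m≤a∨b (comparable-with-join-of-covers unique m⋖a m⋖b a≢b)
        (go (a ∨ b) (rec (length-↑-< m≤a∨b m≢a∨b)))
      where
      m≤a∨b = ≤-trans (m⋖a .m≤c) (x≤x∨y a b)
      m≢a∨b : m ≢ a ∨ b
      m≢a∨b m≡a∨b = m⋖a .m≢c (antisym (m⋖a .m≤c) (subst (a ≤_) (sym m≡a∨b) (x≤x∨y a b)))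

uniqueIncomparableJoins⇒concat : ∀ {n} (L : FinDistLattice n) → Fin n →
                                 UniqueIncomparableJoins L → IsConcatOfDiamondsAndChains L
uniqueIncomparableJoins⇒concat L d unique =
  let z , z≤all = minimum d
      ps , iso  = decompose-↑ z
  in ps , ↾-≅ iso z≤all
  where
  open LatticeProperties L
  open Decomposition L unique

concat⇒uniqueIncomparableJoins : ∀ {n} (L : FinDistLattice n) →
                                 IsConcatOfDiamondsAndChains L → UniqueIncomparableJoins L
concat⇒uniqueIncomparableJoins L (ps , iso) =
  ≅-uniqueIncomparableJoins (concatPieces-isBoundedPreorder ps) iso (concatPieces-uniqueUnrelatedSups ps)

open import Data.Nat using (_≤_)

mainTheorem2 : (n : ℕ) → 1 ≤ n → (L : FinDistLattice n) →
    (nIncomparable L ≡ n ∸ numJ L) ⇔ IsConcatOfDiamondsAndChains L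
mainTheorem2 (suc n) _ L = mk⇔
  (uniqueIncomparableJoins⇒concat L 0F ∘ Equivalence.to count⇔unique)
  (Equivalence.from count⇔unique ∘ concat⇒uniqueIncomparableJoins L)
  where count⇔unique = Counting.count⇔uniqueIncomparableJoins L
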